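{- Let $d\ge 2$, $n\ge d$ and $k\ge 1$ be integers. Then the distance $k$-domination number of the generalized de Bruijn digraph $G_B(n,d)$ satisfies $$\gamma_k(G_B(n,d)) = \left\lceil n \Big/ \sum_{j=0}^k d^j \right\rceil \quad\text{or}\quad \gamma_k(G_B(n,d)) = \left\lceil n \Big/ \sum_{j=0}^k d^j \right\rceil + 1.$$
   Context: Digraphs may have self-loops but no multiple arcs. The generalized de Bruijn digraph $G_B(n,d)$ has vertex set $\{0,1,\dots,n-1\}$ and an arc $(x,y)$ whenever $y\equiv dx+i \pmod n$ for some $0\le i\le d-1$. For vertices $u,v$ of a digraph $G$, the distance $d_G(u,v)$ is the length of a shortest directed path from $u$ to $v$ (with $d_G(u,u)=0$). A set $D\subseteq V(G)$ is a distance $k$-dominating set if every vertex $v\notin D$ has some $u\in D$ with $d_G(u,v)\le k$. The distance $k$-domination number $\gamma_k(G)$ is the minimum cardinality of a distance $k$-dominating set of $G$. -}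

module Defs where

open import Data.Nat using (ℕ; zero; suc; _+_; _*_; _∸_; _^_; _≤_; _<_; _/_; _%_; NonZero)
open import Data.Fin using (Fin; toℕ)
open import Data.Fin.Subset using (Subset; _∈_; _∉_; ∣_∣)
open import Data.Product using (Σ; ∃; ∃-syntax; _×_; _,_)
open import Data.Sum using (_⊎_)
open import Relation.Binary.PropositionalEquality using (_≡_)

Arc : (n d : ℕ) .{{_ : NonZero n}} → Fin n → Fin n → Set
Arc n d x y = ∃[ i ] (i < d × toℕ y ≡ (d * toℕ x + i) % n)

data Walk (n d : ℕ) .{{_ : NonZero n}} : Fin n → Fin n → ℕ → Set where
  here : ∀ {u} → Walk n d u u 0
  step : ∀ {u v w ℓ} → Arc n d u v → Walk n d v w ℓ → Walk n d u w (suc ℓ)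

-- d_G(u,v) ≤ k : there is a directed walk (equivalently, a shortest path)
-- from u to v of length at most k.
DistLe : (n d : ℕ) .{{_ : NonZero n}} → Fin n → Fin n → ℕ → Set
DistLe n d u v k = ∃[ ℓ ] (ℓ ≤ k × Walk n d u v ℓ)

IsDistDomSet : (n d : ℕ) .{{_ : NonZero n}} → ℕ → Subset n → Set
IsDistDomSet n d k D = ∀ v → v ∉ D → ∃[ u ] (u ∈ D × DistLe n d u v k)

IsDistDomNumber : (n d : ℕ) .{{_ : NonZero n}} → ℕ → ℕ → Set
IsDistDomNumber n d k γ =
  (∃[ D ] (IsDistDomSet n d k D × ∣ D ∣ ≡ γ)) ×
  (∀ D → IsDistDomSet n d k D → γ ≤ ∣ D ∣)

geomSum : ℕ → ℕ → ℕ
geomSum d zero = 1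
geomSum d (suc k) = geomSum d k + d ^ suc k

geomSum-nonZero : ∀ d k → NonZero (geomSum d k)
geomSum-nonZero d zero = _
geomSum-nonZero d (suc k) with geomSum d k | geomSum-nonZero d k
... | suc m | _ = _

ceilDiv : ℕ → (s : ℕ) .{{_ : NonZero s}} → ℕ
ceilDiv m s = (m + s ∸ 1) / s

ceilGeom : ℕ → ℕ → ℕ → ℕ
ceilGeom n d k = ceilDiv n (geomSum d k) {{geomSum-nonZero d k}}

module Submission where

-- A walk of length ℓ from u ends at d^ℓ u + i (mod n) for some i < d^ℓ, and every such vertex is
-- reached.  Hence a vertex dominates at most Σ_{j≤k} d^j vertices, which gives the lower bound.  For
-- the upper bound take m = ⌈n / Σ_{j≤k} d^j⌉ + 1 consecutive vertices [a, a + m) with d a ≤ a + m: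
-- at distance j they reach every residue of [d^j a, d^j (a + m)), and for a suitable a these
-- intervals cover n consecutive integers.  The minimum itself exists since domination is decidable.

open import Defs
open import Data.Nat using (ℕ; zero; suc; _+_; _*_; _∸_; _^_; _≤_; _<_; _/_; _%_; NonZero; z≤n; s≤s; _≤?_; _<?_; _≟_)
open import Data.Nat.Properties
open import Data.Nat.DivMod
open import Data.Nat.Tactic.RingSolver using (solve-∀)
open import Data.Fin using (Fin; toℕ; fromℕ<)
open import Data.Fin.Properties using (toℕ<n; toℕ-injective; toℕ-fromℕ<; injective⇒≤; any?; all?) renaming (_≟_ to _≟ᶠ_)
open import Data.Fin.Subset using (Subset; _∈_; ∣_∣; inside; outside; ⊤)
open import Data.Fin.Subset.Properties using (_∈?_; anySubset?; ∈⊤; ∣⊤∣≡n)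
open import Data.Vec using ([]; _∷_; here; there)
open import Data.List using (List; []; _∷_; _++_; map; upTo; length; lookup)
open import Data.List.Properties using (length-map; length-++; length-upTo)
open import Data.List.Membership.Propositional using () renaming (_∈_ to _∈ₗ_)
open import Data.List.Membership.Propositional.Properties using (∈-map⁺; ∈-++⁺ˡ; ∈-++⁺ʳ; ∈-upTo⁺)
open import Data.List.Relation.Unary.Any using (here; there; index)
open import Data.List.Relation.Unary.Any.Properties using (lookup-index)
open import Data.Product using (∃-syntax; _×_; _,_; proj₁; proj₂)
open import Data.Sum using (_⊎_; inj₁; inj₂)
open import Data.Empty using (⊥-elim)
open import Relation.Nullary using (Dec; yes; no)
open import Relation.Nullary.Decidable using (map′; ¬?; _×-dec_; _⊎-dec_; _→-dec_)
open import Relation.Unary using (Pred; Decidable)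
open import Relation.Binary.PropositionalEquality

[a*[b%n]+c]%n≡[a*b+c]%n : ∀ a b c n .{{_ : NonZero n}} → (a * (b % n) + c) % n ≡ (a * b + c) % n
[a*[b%n]+c]%n≡[a*b+c]%n a b c n = begin
  (a * (b % n) + c) % n              ≡⟨ %-distribˡ-+ (a * (b % n)) c n ⟩
  ((a * (b % n)) % n + c % n) % n    ≡⟨ cong (λ z → (z + c % n) % n) [a*[b%n]]%n≡[a*b]%n ⟩
  ((a * b) % n + c % n) % n          ≡⟨ %-distribˡ-+ (a * b) c n ⟨
  (a * b + c) % n                    ∎
  where
  open ≡-Reasoning
  [a*[b%n]]%n≡[a*b]%n : (a * (b % n)) % n ≡ (a * b) % n
  [a*[b%n]]%n≡[a*b]%n = begin
    (a * (b % n)) % n              ≡⟨ %-distribˡ-* a (b % n) n ⟩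
    ((a % n) * (b % n % n)) % n    ≡⟨ cong (λ z → ((a % n) * z) % n) (m%n%n≡m%n b n) ⟩
    ((a % n) * (b % n)) % n        ≡⟨ %-distribˡ-* a b n ⟨
    (a * b) % n                    ∎

p*i+j<p*d : ∀ {p d i j} → i < d → j < p → p * i + j < p * d
p*i+j<p*d {p} {d} {i} {j} i<d j<p = begin-strict
  p * i + j      <⟨ +-monoʳ-< (p * i) j<p ⟩
  p * i + p      ≡⟨ trans (*-suc p i) (+-comm p (p * i)) ⟨
  p * suc i      ≤⟨ *-monoʳ-≤ p i<d ⟩
  p * d          ∎
  where open ≤-Reasoning

module _ {n : ℕ} .{{_ : NonZero n}} (d : ℕ) where

  private
    toℕ≡[d^0*u+0]%n : ∀ (u : Fin n) → toℕ u ≡ (d ^ 0 * toℕ u + 0) % n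
    toℕ≡[d^0*u+0]%n u = sym (begin
      (1 * toℕ u + 0) % n  ≡⟨ cong (_% n) (trans (+-identityʳ _) (*-identityˡ (toℕ u))) ⟩
      toℕ u % n            ≡⟨ m<n⇒m%n≡m (toℕ<n u) ⟩
      toℕ u                ∎)
      where open ≡-Reasoning

  walk⇒offset : ∀ {u v ℓ} → Walk n d u v ℓ → ∃[ i ] (i < d ^ ℓ × toℕ v ≡ (d ^ ℓ * toℕ u + i) % n)
  walk⇒offset {u} here = 0 , s≤s z≤n , toℕ≡[d^0*u+0]%n u
  walk⇒offset {u} {v} {suc ℓ} (step {v = w} (i₀ , i₀<d , w≡) rest) with walk⇒offset rest
  ... | i₁ , i₁<d^ℓ , v≡ = d ^ ℓ * i₀ + i₁ ,
                           subst (d ^ ℓ * i₀ + i₁ <_) (*-comm (d ^ ℓ) d) (p*i+j<p*d i₀<d i₁<d^ℓ) ,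
                           (begin
    toℕ v                                          ≡⟨ v≡ ⟩
    (d ^ ℓ * toℕ w + i₁) % n                       ≡⟨ cong (λ z → (d ^ ℓ * z + i₁) % n) w≡ ⟩
    (d ^ ℓ * ((d * toℕ u + i₀) % n) + i₁) % n      ≡⟨ [a*[b%n]+c]%n≡[a*b+c]%n (d ^ ℓ) (d * toℕ u + i₀) i₁ n ⟩
    (d ^ ℓ * (d * toℕ u + i₀) + i₁) % n            ≡⟨ cong (_% n) (shift (d ^ ℓ) d (toℕ u) i₀ i₁) ⟩
    (d ^ suc ℓ * toℕ u + (d ^ ℓ * i₀ + i₁)) % n    ∎)
    where
    open ≡-Reasoning
    shift : ∀ p d x i j → p * (d * x + i) + j ≡ (d * p) * x + (p * i + j)
    shift = solve-∀

  _▷_ : ∀ {u v w ℓ} → Walk n d u v ℓ → Arc n d v w → Walk n d u w (suc ℓ)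
  here         ▷ a = step a here
  step a′ rest ▷ a = step a′ (rest ▷ a)

  -- The offset i is written in base d: its last digit i % d labels the last arc.
  offset⇒walk : .{{_ : NonZero d}} → ∀ ℓ u i → i < d ^ ℓ →
                ∃[ v ] (toℕ v ≡ (d ^ ℓ * toℕ u + i) % n × Walk n d u v ℓ)
  offset⇒walk zero    u zero    _        = u , toℕ≡[d^0*u+0]%n u , here
  offset⇒walk zero    u (suc i) (s≤s ())
  offset⇒walk (suc ℓ) u i       i<d^1+ℓ
    with offset⇒walk ℓ u (i / d) (m<n*o⇒m/o<n (subst (i <_) (*-comm d (d ^ ℓ)) i<d^1+ℓ))
  ... | x , x≡ , walk = y , y≡ , walk ▷ (i % d , m%n<n i d , toℕ-fromℕ< _)
    where
    y : Fin n
    y = (d * toℕ x + i % d) mod n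
    y≡ : toℕ y ≡ (d ^ suc ℓ * toℕ u + i) % n
    y≡ = begin
      toℕ y                                           ≡⟨ toℕ-fromℕ< _ ⟩
      (d * toℕ x + i % d) % n                         ≡⟨ cong (λ z → (d * z + i % d) % n) x≡ ⟩
      (d * ((d ^ ℓ * toℕ u + i / d) % n) + i % d) % n ≡⟨ [a*[b%n]+c]%n≡[a*b+c]%n d _ (i % d) n ⟩
      (d * (d ^ ℓ * toℕ u + i / d) + i % d) % n       ≡⟨ cong (_% n) (shift (d ^ ℓ) d (toℕ u) (i / d) (i % d)) ⟩
      (d ^ suc ℓ * toℕ u + (i % d + i / d * d)) % n   ≡⟨ cong (λ z → (d ^ suc ℓ * toℕ u + z) % n) (m≡m%n+[m/n]*n i d) ⟨
      (d ^ suc ℓ * toℕ u + i) % n                     ∎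
      where
      open ≡-Reasoning
      shift : ∀ p d x q r → d * (p * x + q) + r ≡ (d * p) * x + (r + q * d)
      shift = solve-∀

  walkEnds : ℕ → Fin n → List (Fin n)
  walkEnds ℓ u = map (λ i → (d ^ ℓ * toℕ u + i) mod n) (upTo (d ^ ℓ))

  ball : ℕ → Fin n → List (Fin n)
  ball zero    u = walkEnds 0 u
  ball (suc k) u = ball k u ++ walkEnds (suc k) u

  length-walkEnds : ∀ ℓ u → length (walkEnds ℓ u) ≡ d ^ ℓ
  length-walkEnds ℓ u = trans (length-map _ (upTo (d ^ ℓ))) (length-upTo (d ^ ℓ))

  length-ball : ∀ k u → length (ball k u) ≡ geomSum d k
  length-ball zero    u = length-walkEnds 0 u
  length-ball (suc k) u = trans (length-++ (ball k u)) (cong₂ _+_ (length-ball k u) (length-walkEnds (suc k) u))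

  walkEnds⊆ball : ∀ {ℓ k u v} → ℓ ≤ k → v ∈ₗ walkEnds ℓ u → v ∈ₗ ball k u
  walkEnds⊆ball {zero}  {zero}  _  v∈ = v∈
  walkEnds⊆ball {ℓ}     {suc k} ℓ≤ v∈ with m≤n⇒m<n∨m≡n ℓ≤
  ... | inj₁ ℓ<     = ∈-++⁺ˡ (walkEnds⊆ball (≤-pred ℓ<) v∈)
  ... | inj₂ refl   = ∈-++⁺ʳ _ v∈

  distLe⇒∈ball : ∀ {u v k} → DistLe n d u v k → v ∈ₗ ball k u
  distLe⇒∈ball {u} {v} (ℓ , ℓ≤k , walk) with walk⇒offset walk
  ... | i , i<d^ℓ , v≡ = walkEnds⊆ball ℓ≤k
    (subst (_∈ₗ walkEnds ℓ u) (toℕ-injective (trans (toℕ-fromℕ< _) (sym v≡))) (∈-map⁺ _ (∈-upTo⁺ i<d^ℓ)))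

  balls : ℕ → List (Fin n) → List (Fin n)
  balls k []       = []
  balls k (u ∷ us) = ball k u ++ balls k us

  length-balls : ∀ k us → length (balls k us) ≡ length us * geomSum d k
  length-balls k []       = refl
  length-balls k (u ∷ us) = trans (length-++ (ball k u)) (cong₂ _+_ (length-ball k u) (length-balls k us))

  ∈ball⇒∈balls : ∀ k {u v us} → u ∈ₗ us → v ∈ₗ ball k u → v ∈ₗ balls k us
  ∈ball⇒∈balls k (here refl)       v∈ = ∈-++⁺ˡ v∈
  ∈ball⇒∈balls k {us = u ∷ _} (there u∈) v∈ = ∈-++⁺ʳ (ball k u) (∈ball⇒∈balls k u∈ v∈)

elements : ∀ {m} → Subset m → List (Fin m)
elements []            = []
elements (inside ∷ p)  = Fin.zero ∷ map Fin.suc (elements p)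
elements (outside ∷ p) = map Fin.suc (elements p)

length-elements : ∀ {m} (p : Subset m) → length (elements p) ≡ ∣ p ∣
length-elements []            = refl
length-elements (inside ∷ p)  = cong suc (trans (length-map _ (elements p)) (length-elements p))
length-elements (outside ∷ p) = trans (length-map _ (elements p)) (length-elements p)

∈⇒∈elements : ∀ {m} {x : Fin m} {p : Subset m} → x ∈ p → x ∈ₗ elements p
∈⇒∈elements {p = inside ∷ p}  here      = here refl
∈⇒∈elements {p = inside ∷ p}  (there q) = there (∈-map⁺ Fin.suc (∈⇒∈elements q))
∈⇒∈elements {p = outside ∷ p} (there q) = ∈-map⁺ Fin.suc (∈⇒∈elements q)

complete⇒≤length : ∀ {m} (xs : List (Fin m)) → (∀ x → x ∈ₗ xs) → m ≤ length xs
complete⇒≤length xs complete = injective⇒≤ {f = λ x → index (complete x)} λ {x} {y} eq → begin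
  x                               ≡⟨ lookup-index (complete x) ⟩
  lookup xs (index (complete x))  ≡⟨ cong (lookup xs) eq ⟩
  lookup xs (index (complete y))  ≡⟨ lookup-index (complete y) ⟨
  y                               ∎
  where open ≡-Reasoning

ceilDiv≡[m+s]/[1+s] : ∀ m s → ceilDiv m (suc s) ≡ (m + s) / suc s
ceilDiv≡[m+s]/[1+s] m s = cong (λ x → (x ∸ 1) / suc s) (+-suc m s)

ceilDiv-least : ∀ m s .{{_ : NonZero s}} c → m ≤ c * s → ceilDiv m s ≤ c
ceilDiv-least m (suc s) c m≤c*s rewrite ceilDiv≡[m+s]/[1+s] m s = ≤-pred (m<n*o⇒m/o<n (begin-strict
  m + s                <⟨ +-monoʳ-< m (n<1+n s) ⟩
  m + suc s            ≤⟨ +-monoˡ-≤ (suc s) m≤c*s ⟩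
  c * suc s + suc s    ≡⟨ +-comm (c * suc s) (suc s) ⟩
  suc c * suc s        ∎))
  where open ≤-Reasoning

≤ceilDiv*s : ∀ m s .{{_ : NonZero s}} → m ≤ ceilDiv m s * s
≤ceilDiv*s m (suc s) rewrite ceilDiv≡[m+s]/[1+s] m s = ≤-pred (+-cancelʳ-< s m (suc (q * suc s)) (begin-strict
  m + s                        ≡⟨ m≡m%n+[m/n]*n (m + s) (suc s) ⟩
  (m + s) % suc s + q * suc s  <⟨ +-monoˡ-< (q * suc s) (m%n<n (m + s) (suc s)) ⟩
  suc s + q * suc s            ≡⟨ cong suc (+-comm s (q * suc s)) ⟩
  suc (q * suc s) + s          ∎))
  where
  open ≤-Reasoning
  q : ℕ
  q = (m + s) / suc s

ceilGeom≤∣D∣ : ∀ {n} .{{_ : NonZero n}} d k D → IsDistDomSet n d k D → ceilGeom n d k ≤ ∣ D ∣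
ceilGeom≤∣D∣ {n} d k D dominating =
  ceilDiv-least n (geomSum d k) {{geomSum-nonZero d k}} ∣ D ∣ (subst (n ≤_) length≡ (complete⇒≤length _ covered))
  where
  length≡ : length (balls d k (elements D)) ≡ ∣ D ∣ * geomSum d k
  length≡ = trans (length-balls d k (elements D)) (cong (_* geomSum d k) (length-elements D))
  covered : ∀ v → v ∈ₗ balls d k (elements D)
  covered v with v ∈? D
  ... | yes v∈D = ∈ball⇒∈balls d k (∈⇒∈elements v∈D) (distLe⇒∈ball d {k = k} (0 , z≤n , here))
  ... | no  v∉D with u , u∈D , u→v ← dominating v v∉D = ∈ball⇒∈balls d k (∈⇒∈elements u∈D) (distLe⇒∈ball d u→v)

segment : (N a m : ℕ) → Subset N
segment zero    _       _       = []
segment (suc N) zero    zero    = outside ∷ segment N 0 0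
segment (suc N) zero    (suc m) = inside ∷ segment N 0 m
segment (suc N) (suc a) m       = outside ∷ segment N a m

∣segment∣≤ : ∀ N a m → ∣ segment N a m ∣ ≤ m
∣segment∣≤ zero    a       m       = z≤n
∣segment∣≤ (suc N) zero    zero    = ∣segment∣≤ N 0 0
∣segment∣≤ (suc N) zero    (suc m) = s≤s (∣segment∣≤ N 0 m)
∣segment∣≤ (suc N) (suc a) m       = ∣segment∣≤ N a m

∈segment : ∀ N a m (x : Fin N) → a ≤ toℕ x → toℕ x < a + m → x ∈ segment N a m
∈segment (suc N) zero    (suc m) Fin.zero    _       _         = here
∈segment (suc N) zero    (suc m) (Fin.suc x) _       (s≤s x<m) = there (∈segment N 0 m x z≤n x<m)
∈segment (suc N) (suc a) m       (Fin.suc x) (s≤s a≤x) (s≤s x<) = there (∈segment N a m x a≤x x<)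

-- If d a ≤ a + m, consecutive intervals [d^j a, d^j (a + m)) overlap, so together they cover [a, d^k (a + m)).
interval-cover : ∀ {d a m} → d * a ≤ a + m → ∀ k {y} → a ≤ y → y < d ^ k * (a + m) →
                 ∃[ j ] (j ≤ k × d ^ j * a ≤ y × y < d ^ j * (a + m))
interval-cover da≤a+m zero a≤y y< = 0 , z≤n , subst (_≤ _) (sym (*-identityˡ _)) a≤y , y<
interval-cover {d} {a} {m} da≤a+m (suc k) {y} a≤y y< with y <? d ^ k * (a + m)
... | yes y<′ with j , j≤k , rest ← interval-cover da≤a+m k a≤y y<′ = j , m≤n⇒m≤1+n j≤k , rest
... | no  y≮  = suc k , ≤-refl , (begin
  d * d ^ k * a     ≡⟨ trans (cong (_* a) (*-comm d (d ^ k))) (*-assoc (d ^ k) d a) ⟩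
  d ^ k * (d * a)   ≤⟨ *-monoʳ-≤ (d ^ k) da≤a+m ⟩
  d ^ k * (a + m)   ≤⟨ ≮⇒≥ y≮ ⟩
  y                 ∎) , y<
  where open ≤-Reasoning

/-between : ∀ p {a b y} .{{_ : NonZero p}} → p * a ≤ y → y < p * b → a ≤ y / p × y / p < b
/-between p {a} {b} {y} p*a≤y y<p*b =
  subst (_≤ y / p) (m*n/n≡m a p) (/-monoˡ-≤ p (subst (_≤ y) (*-comm p a) p*a≤y)) ,
  m<n*o⇒m/o<n (subst (y <_) (*-comm p b) y<p*b)

residue-lift : ∀ {n} .{{_ : NonZero n}} {a} → a ≤ n → (v : Fin n) →
               ∃[ y ] (a ≤ y × y < n + a × y % n ≡ toℕ v)
residue-lift {n} {a} a≤n v with a ≤? toℕ v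
... | yes a≤v = toℕ v , a≤v , ≤-trans (toℕ<n v) (m≤m+n n a) , m<n⇒m%n≡m (toℕ<n v)
... | no  a≰v = toℕ v + n , ≤-trans a≤n (m≤n+m n (toℕ v)) ,
                subst (_≤ n + a) (+-comm n (suc (toℕ v))) (+-monoʳ-≤ n (≰⇒> a≰v)) ,
                trans ([m+n]%n≡m%n (toℕ v) n) (m<n⇒m%n≡m (toℕ<n v))

-- A vertex v is reached from u = y / d^j by the walk with offset y % d^j, where y ≡ v (mod n).
segment-dominates : ∀ {n} .{{_ : NonZero n}} d k .{{_ : NonZero d}} {a m} →
                    d * a ≤ a + m → a + m ≤ n → n + a ≤ d ^ k * (a + m) →
                    ∀ v → ∃[ u ] (u ∈ segment n a m × DistLe n d u v k)
segment-dominates {n} d k {a} {m} da≤a+m a+m≤n n+a≤ v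
  with y , a≤y , y<n+a , y≡v ← residue-lift (≤-trans (m≤m+n a m) a+m≤n) v
  with j , j≤k , lo , hi ← interval-cover da≤a+m k a≤y (≤-trans y<n+a n+a≤)
  = u , ∈segment n a m u (subst (a ≤_) (sym toℕu≡u′) a≤u′) (subst (_< a + m) (sym toℕu≡u′) u′<a+m) ,
    j , j≤k , subst (λ z → Walk n d u z j) w≡v walk
  where
  instance
    d^j≢0 : NonZero (d ^ j)
    d^j≢0 = m^n≢0 d j
  u′ : ℕ
  u′ = y / d ^ j
  a≤u′ : a ≤ u′
  a≤u′ = proj₁ (/-between (d ^ j) lo hi)
  u′<a+m : u′ < a + m
  u′<a+m = proj₂ (/-between (d ^ j) lo hi)
  u : Fin n
  u = fromℕ< (≤-trans u′<a+m a+m≤n)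
  toℕu≡u′ : toℕ u ≡ u′
  toℕu≡u′ = toℕ-fromℕ< _
  endpoint : ∃[ w ] (toℕ w ≡ (d ^ j * toℕ u + y % d ^ j) % n × Walk n d u w j)
  endpoint = offset⇒walk d j u (y % d ^ j) (m%n<n y (d ^ j))
  w : Fin n
  w = proj₁ endpoint
  walk : Walk n d u w j
  walk = proj₂ (proj₂ endpoint)
  w≡v : w ≡ v
  w≡v = toℕ-injective (begin
    toℕ w                              ≡⟨ proj₁ (proj₂ endpoint) ⟩
    (d ^ j * toℕ u + y % d ^ j) % n    ≡⟨ cong (λ z → (d ^ j * z + y % d ^ j) % n) toℕu≡u′ ⟩
    (d ^ j * u′ + y % d ^ j) % n       ≡⟨ cong (_% n) (trans (+-comm (d ^ j * u′) (y % d ^ j)) (cong (y % d ^ j +_) (*-comm (d ^ j) u′))) ⟩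
    (y % d ^ j + u′ * d ^ j) % n       ≡⟨ cong (_% n) (m≡m%n+[m/n]*n y (d ^ j)) ⟨
    y % n                              ≡⟨ y≡v ⟩
    toℕ v                              ∎)
    where open ≡-Reasoning

segment-dominating-set : ∀ {n} .{{_ : NonZero n}} d k .{{_ : NonZero d}} {a m} →
                         d * a ≤ a + m → a + m ≤ n → n + a ≤ d ^ k * (a + m) →
                         ∃[ D ] (IsDistDomSet n d k D × ∣ D ∣ ≤ m)
segment-dominating-set {n} d k {a} {m} da≤a+m a+m≤n n+a≤ =
  segment n a m , (λ v _ → segment-dominates d k da≤a+m a+m≤n n+a≤ v) , ∣segment∣≤ n a m

e*geomSum+1≡[1+e]^[1+k] : ∀ e k → e * geomSum (suc e) k + 1 ≡ suc e ^ suc k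
e*geomSum+1≡[1+e]^[1+k] e zero    = +-comm (e * 1) 1
e*geomSum+1≡[1+e]^[1+k] e (suc k) = begin
  e * (G + Q) + 1      ≡⟨ regroup e G Q ⟩
  (e * G + 1) + e * Q  ≡⟨ cong (_+ e * Q) (e*geomSum+1≡[1+e]^[1+k] e k) ⟩
  Q + e * Q            ∎
  where
  open ≡-Reasoning
  G Q : ℕ
  G = geomSum (suc e) k
  Q = suc e ^ suc k
  regroup : ∀ e G Q → e * (G + Q) + 1 ≡ (e * G + 1) + e * Q
  regroup = solve-∀

-- The inequality behind the choice a = ⌊(c + 1) / e⌋ in the upper bound; here e = d − 1, P = d^k and
-- S = Σ_{j≤k} d^j, so that e S + 1 = d P.  Both sides are multiplied by e and padded with c + P to
-- avoid subtraction.
window-fits : ∀ {n c e P S r q} .{{_ : NonZero e}} → e * S + 1 ≡ suc e * P → 1 ≤ P →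
              n ≤ c * S → suc c ≡ r + q * e → r < e → n + q ≤ P * (q + suc c)
window-fits {n} {c} {e} {P} {S} {r} {q} eS+1≡ 1≤P n≤cS 1+c≡ r<e =
  ≤-trans (+-monoˡ-≤ q n≤cS) (*-cancelˡ-≤ e (+-cancelʳ-≤ c _ _ (+-cancelʳ-≤ P _ _ padded)))
  where
  open ≤-Reasoning
  eq≤1+c : e * q ≤ suc c
  eq≤1+c = subst (_≤ suc c) (*-comm q e) (subst (q * e ≤_) (sym 1+c≡) (m≤n+m (q * e) r))
  rP+eq≤ : r * P + e * q ≤ e * P + P + c
  rP+eq≤ = begin
    r * P + e * q      ≤⟨ +-monoʳ-≤ (r * P) (≤-trans eq≤1+c (+-monoˡ-≤ c 1≤P)) ⟩
    r * P + (P + c)    ≡⟨ +-assoc (r * P) P c ⟨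
    r * P + P + c      ≡⟨ cong (_+ c) (+-comm (r * P) P) ⟩
    suc r * P + c      ≤⟨ +-monoˡ-≤ c (*-monoˡ-≤ P r<e) ⟩
    e * P + c          ≤⟨ +-monoˡ-≤ c (m≤m+n (e * P) P) ⟩
    e * P + P + c      ∎
  padded : e * (c * S + q) + c + P ≤ e * (P * (q + suc c)) + c + P
  padded = begin
    e * (c * S + q) + c + P                    ≡⟨ ring₁ e c S q P ⟩
    c * (e * S + 1) + e * q + P                ≡⟨ cong (λ z → c * z + e * q + P) eS+1≡ ⟩
    c * (suc e * P) + e * q + P                ≡⟨ ring₂ c e P q ⟩
    c * e * P + suc c * P + e * q              ≡⟨ cong (λ z → c * e * P + z * P + e * q) 1+c≡ ⟩
    c * e * P + (r + q * e) * P + e * q        ≡⟨ ring₃ c e P r q ⟩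
    (c * e * P + q * e * P) + (r * P + e * q)  ≤⟨ +-monoʳ-≤ (c * e * P + q * e * P) rP+eq≤ ⟩
    (c * e * P + q * e * P) + (e * P + P + c)  ≡⟨ ring₄ c e P q ⟩
    e * (P * (q + suc c)) + c + P              ∎
    where
    ring₁ : ∀ e c S q P → e * (c * S + q) + c + P ≡ c * (e * S + 1) + e * q + P
    ring₁ = solve-∀
    ring₂ : ∀ c e P q → c * (suc e * P) + e * q + P ≡ c * e * P + suc c * P + e * q
    ring₂ = solve-∀
    ring₃ : ∀ c e P r q → c * e * P + (r + q * e) * P + e * q ≡ (c * e * P + q * e * P) + (r * P + e * q)
    ring₃ = solve-∀
    ring₄ : ∀ c e P q → (c * e * P + q * e * P) + (e * P + P + c) ≡ e * (P * (q + suc c)) + c + P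
    ring₄ = solve-∀

-- With m = c + 1 and e = d − 1, the segment [a, a + m) dominates for a = ⌊m / e⌋ when it fits below n,
-- and for a = n − m otherwise.
small-dominating-set : ∀ n d k → 2 ≤ d → 1 ≤ k → .{{_ : NonZero n}} →
                       ∃[ D ] (IsDistDomSet n d k D × ∣ D ∣ ≤ suc (ceilGeom n d k))
small-dominating-set n 0                  k         ()           _
small-dominating-set n 1                  k         (s≤s ())     _
small-dominating-set n (suc (suc _))      0         _            ()
small-dominating-set n d@(suc e@(suc _)) k@(suc _) _ _ with n ≤? suc (ceilGeom n d k)
... | yes n≤m = ⊤ , (λ v v∉⊤ → ⊥-elim (v∉⊤ ∈⊤)) , subst (_≤ suc (ceilGeom n d k)) (sym (∣⊤∣≡n n)) n≤m
... | no  n≰m = dominating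
  where
  c m q : ℕ
  c = ceilGeom n d k
  m = suc c
  q = m / e
  e*q≤m : e * q ≤ m
  e*q≤m = subst (_≤ m) (*-comm q e) (m/n*n≤m m e)
  dominating : ∃[ D ] (IsDistDomSet n d k D × ∣ D ∣ ≤ m)
  dominating with q + m ≤? n
  ... | yes q+m≤n = segment-dominating-set d k (+-monoʳ-≤ q e*q≤m) q+m≤n
    (window-fits (e*geomSum+1≡[1+e]^[1+k] e k) (m^n>0 d k) (≤ceilDiv*s n (geomSum d k) {{geomSum-nonZero d k}})
                 (m≡m%n+[m/n]*n m e) (m%n<n m e))
  ... | no  q+m≰n = segment-dominating-set d k (+-monoʳ-≤ a (≤-trans (*-monoʳ-≤ e a≤q) e*q≤m)) (≤-reflexive a+m≡n) n+a≤
    where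
    a : ℕ
    a = n ∸ m
    a+m≡n : a + m ≡ n
    a+m≡n = m∸n+n≡m (<⇒≤ (≰⇒> n≰m))
    a≤q : a ≤ q
    a≤q = subst (a ≤_) (m+n∸n≡m q m) (∸-monoˡ-≤ m (<⇒≤ (≰⇒> q+m≰n)))
    n+a≤ : n + a ≤ d ^ k * (a + m)
    n+a≤ = begin
      n + a              ≤⟨ +-monoʳ-≤ n (m∸n≤m n m) ⟩
      n + n              ≡⟨ cong (n +_) (+-identityʳ n) ⟨
      2 * n              ≤⟨ *-monoˡ-≤ n (≤-trans (s≤s (s≤s z≤n)) (^-monoʳ-≤ d {1} {k} (s≤s z≤n))) ⟩
      d ^ k * n          ≡⟨ cong (d ^ k *_) a+m≡n ⟨
      d ^ k * (a + m)    ∎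
      where open ≤-Reasoning

module _ {n : ℕ} .{{_ : NonZero n}} (d : ℕ) where

  Arc? : ∀ x y → Dec (Arc n d x y)
  Arc? x y = map′ (λ (i , y≡) → toℕ i , toℕ<n i , y≡) digit (any? (λ (i : Fin d) → toℕ y ≟ (d * toℕ x + toℕ i) % n))
    where
    digit : Arc n d x y → ∃[ i ] (toℕ y ≡ (d * toℕ x + toℕ {d} i) % n)
    digit (i , i<d , y≡) = fromℕ< i<d , subst (λ z → toℕ y ≡ (d * toℕ x + z) % n) (sym (toℕ-fromℕ< i<d)) y≡

  DistLe? : ∀ k u v → Dec (DistLe n d u v k)
  DistLe? zero u v = map′ (λ { refl → 0 , z≤n , here }) (λ { (.0 , z≤n , here) → refl }) (u ≟ᶠ v)
  DistLe? (suc k) u v = map′ to from ((u ≟ᶠ v) ⊎-dec any? (λ w → Arc? u w ×-dec DistLe? k w v))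
    where
    to : u ≡ v ⊎ ∃[ w ] (Arc n d u w × DistLe n d w v k) → DistLe n d u v (suc k)
    to (inj₁ refl)                      = 0 , z≤n , here
    to (inj₂ (w , arc , ℓ , ℓ≤k , walk)) = suc ℓ , s≤s ℓ≤k , step arc walk
    from : DistLe n d u v (suc k) → u ≡ v ⊎ ∃[ w ] (Arc n d u w × DistLe n d w v k)
    from (.0 , _ , here)                        = inj₁ refl
    from (suc ℓ , s≤s ℓ≤k , step {v = w} arc walk) = inj₂ (w , arc , ℓ , ℓ≤k , walk)

  IsDistDomSet? : ∀ k D → Dec (IsDistDomSet n d k D)
  IsDistDomSet? k D = all? (λ v → ¬? (v ∈? D) →-dec any? (λ u → (u ∈? D) ×-dec DistLe? k u v))

minimum-exists : ∀ {n p} {P : Pred (Subset n) p} → Decidable P → ∀ {D₀} → P D₀ →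
                 ∃[ γ ] ((∃[ D ] (P D × ∣ D ∣ ≡ γ)) × (∀ D → P D → γ ≤ ∣ D ∣))
minimum-exists {P = P} P? {D₀} PD₀ = search ∣ D₀ ∣ (D₀ , PD₀ , ≤-refl)
  where
  search : ∀ b → ∃[ D ] (P D × ∣ D ∣ ≤ b) → ∃[ γ ] ((∃[ D ] (P D × ∣ D ∣ ≡ γ)) × (∀ D → P D → γ ≤ ∣ D ∣))
  search zero (D , PD , ∣D∣≤0) = ∣ D ∣ , (D , PD , refl) , λ _ _ → ≤-trans ∣D∣≤0 z≤n
  search (suc b) (D , PD , ∣D∣≤1+b) with anySubset? (λ D′ → P? D′ ×-dec (∣ D′ ∣ ≤? b))
  ... | yes smaller = search b smaller
  ... | no  none    = ∣ D ∣ , (D , PD , refl) ,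
                      λ D′ PD′ → ≤-trans ∣D∣≤1+b (≰⇒> (λ ∣D′∣≤b → none (D′ , PD′ , ∣D′∣≤b)))

m≤n≤1+m⇒n≡m⊎n≡m+1 : ∀ {m n} → m ≤ n → n ≤ suc m → n ≡ m ⊎ n ≡ m + 1
m≤n≤1+m⇒n≡m⊎n≡m+1 {m} m≤n n≤1+m with m≤n⇒m<n∨m≡n n≤1+m
... | inj₁ n<1+m = inj₁ (≤-antisym (≤-pred n<1+m) m≤n)
... | inj₂ n≡1+m = inj₂ (trans n≡1+m (+-comm 1 m))

theorem2p1 : (n d k : ℕ) → 2 ≤ d → d ≤ n → 1 ≤ k →
    .{{_ : NonZero n}} →
    ∃[ γ ] (IsDistDomNumber n d k γ ×
      (γ ≡ ceilGeom n d k ⊎ γ ≡ ceilGeom n d k + 1))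
theorem2p1 n d k 2≤d _ 1≤k
  with D₀ , D₀-dominates , ∣D₀∣≤ ← small-dominating-set n d k 2≤d 1≤k
  with γ , (D , D-dominates , ∣D∣≡γ) , γ-least ← minimum-exists (IsDistDomSet? d k) D₀-dominates
  = γ , ((D , D-dominates , ∣D∣≡γ) , γ-least) ,
    m≤n≤1+m⇒n≡m⊎n≡m+1 (subst (ceilGeom n d k ≤_) ∣D∣≡γ (ceilGeom≤∣D∣ d k D D-dominates))
                      (≤-trans (γ-least D₀ D₀-dominates) ∣D₀∣≤)
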